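{- For $t\in\mathbb{C}_2$ let $f_t(z)=z^3-\frac32 t z^2\in\mathbb{C}_2[z]$, whose critical points are $0$ and $t$. Call $f_t$ post-critically bounded if both critical points have bounded forward orbit under $f_t$ (with respect to the $2$-adic absolute value). Then: (1) for every integer $k\ge 2$, with $t_k=1+2^{2k}$, the polynomial $f_{t_k}$ is not post-critically bounded; (2) for every integer $m\ge 2$, with $t_m=1+3\cdot 2^{2m+1}$, the polynomial $f_{t_m}$ is post-critically bounded.
   Context: $\mathbb{C}_2$ is the completion of an algebraic closure of $\mathbb{Q}_2$ with its $2$-adic absolute value. -}

module Defs where

open import Data.Nat as ℕ using (ℕ; zero; suc)
open import Data.Nat.Properties using (m^n≢0)
open import Data.Integer as ℤ using (ℤ; +_)
open import Data.Rational using (ℚ; _+_; _*_; _-_; _≤_; ↥_; ↧ₙ_; 0ℚ; 1ℚ; _/_)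
open import Data.Product using (Σ; _×_)
open import Relation.Nullary using (does)
open import Data.Bool using (if_then_else_)

-- 2-adic valuation of a natural number (v₂ 0 = 0 by convention; it is
-- only used on nonzero arguments).  Fuel-based recursion: fuel n suffices.
v₂-aux : ℕ → ℕ → ℕ
v₂-aux zero    n = 0
v₂-aux (suc f) zero = 0
v₂-aux (suc f) (suc n) =
  if does (suc n ℕ.% 2 ℕ.≟ 0) then suc (v₂-aux f (suc n ℕ./ 2)) else 0

v₂ : ℕ → ℕ
v₂ n = v₂-aux n n

∣_∣₂ : ℚ → ℚ
∣ x ∣₂ with ℤ.∣ ↥ x ∣
... | zero  = 0ℚ
... | suc a = _/_ (+ (2 ℕ.^ v₂ (↧ₙ x))) (2 ℕ.^ v₂ (suc a)) {{m^n≢0 2 (v₂ (suc a))}}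

f : ℚ → ℚ → ℚ
f t z = z * z * z - ((+ 3) / 2) * t * z * z

iter : (ℚ → ℚ) → ℕ → ℚ → ℚ
iter g zero    z = z
iter g (suc n) z = g (iter g n z)

BoundedOrbit : ℚ → ℚ → Set
BoundedOrbit t c = Σ ℚ (λ B → (n : ℕ) → ∣ iter (f t) n c ∣₂ ≤ B)

PCB : ℚ → Set
PCB t = BoundedOrbit t 0ℚ × BoundedOrbit t t

tA : ℕ → ℚ
tA k = (+ (1 ℕ.+ 2 ℕ.^ (2 ℕ.* k))) / 1

tB : ℕ → ℚ
tB m = (+ (1 ℕ.+ 3 ℕ.* 2 ℕ.^ (2 ℕ.* m ℕ.+ 1))) / 1

-- Both parameters are odd integers T, and the orbit of the critical point 0 is {0}.  For the
-- critical point t we rescale: writing orbit points as z = w/2, one step of f_t becomes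
-- w ↦ w²(w − 3T)/4 (the relation 'Step').  All points of the orbits are then controlled by
-- explicit integer certificates, checked by the ring solver, which track the 2-adic shape of w:
--   * part (2): w enters the "cascade" w = 4·4^i·(4q + 1) − 1, loses one level per step, and
--     then stays among the multiples of 4; every point is a half-integer, so |z|₂ ≤ 2;
--   * part (1): w enters the cascade w = 8·4^i·(2q + 1) − 1, descends it, and then w − 3T is
--     only divisible by 2, so the next point has |z|₂ = 4; from then on |f_t z|₂ = |z|₂³.

module Submission where

open import Defs
open import Data.Nat using (ℕ; _≤_)
open import Data.Product using (_×_)
open import Relation.Nullary using (¬_)

open import Data.Nat as ℕ using (zero; suc; s≤s; z≤n; _^_)
import Data.Nat.Properties as ℕP
import Data.Nat.DivMod as ℕD
open import Data.Nat.Divisibility as ℕ∣ using (_∣_; divides)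
import Data.Nat.Coprimality as Coprimality
open import Data.Nat.GCD using (gcd)
open import Data.Nat.Primality using (euclidsLemma; prime[2])
open import Data.Integer as ℤ using (ℤ; +_; -[1+_]; _+_; _*_; _-_; -_)
import Data.Integer.Properties as ℤP
import Data.Integer.Divisibility.Signed as ℤ∣
open import Data.Integer.Tactic.RingSolver using (solve-∀) renaming (solve to solve-ℤ)
open import Data.Nat.Tactic.RingSolver using () renaming (solve-∀ to solve-∀-ℕ; solve to solve-ℕ)
open import Data.Rational as Q using (ℚ; mkℚ; _/_; ½; 0ℚ; ↥_; ↧ₙ_)
import Data.Rational.Properties as ℚP
open import Data.Rational.Unnormalised using (mkℚᵘ; *≡*)
open import Data.Rational.Solver using (module +-*-Solver)
open import Data.Product using (Σ; _,_)
open import Data.Sum using (_⊎_; inj₁; inj₂)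
open import Data.Empty using (⊥-elim)
open import Data.List using (_∷_; [])
open import Relation.Binary.PropositionalEquality

ι : ℤ → ℚ
ι a = a / 1

coprime-1 : ∀ n → Coprimality.Coprime n 1
coprime-1 n (_ , d∣1) = ℕ∣.∣1⇒≡1 d∣1

ι-normal : ∀ a → ι a ≡ mkℚ a 0 (coprime-1 ℤ.∣ a ∣)
ι-normal a = ℚP.↥p/↧p≡p (mkℚ a 0 (coprime-1 ℤ.∣ a ∣))

ι-* : ∀ a b → ι (a * b) ≡ ι a Q.* ι b
ι-* a b = sym (cong₂ Q._*_ (ι-normal a) (ι-normal b))

ι-+ : ∀ a b → ι (a + b) ≡ ι a Q.+ ι b
ι-+ a b = sym (trans (cong₂ Q._+_ (ι-normal a) (ι-normal b))
                     (cong ι (cong₂ _+_ (ℤP.*-identityʳ a) (ℤP.*-identityʳ b))))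

ι-neg : ∀ a → ι (- a) ≡ Q.- ι a
ι-neg (+ zero)   = refl
ι-neg ℤ.+[1+ n ] = refl
ι-neg -[1+ n ]   = trans (ι-normal ℤ.+[1+ n ]) (sym (cong Q.-_ (ι-normal -[1+ n ])))

ι-- : ∀ a b → ι (a - b) ≡ ι a Q.- ι b
ι-- a b = trans (ι-+ a (- b)) (cong (λ q → ι a Q.+ q) (ι-neg b))

ι-mono : ∀ {m n} → m ℕ.≤ n → ι (+ m) Q.≤ ι (+ n)
ι-mono {m} {n} m≤n = subst₂ Q._≤_ (sym (ι-normal (+ m))) (sym (ι-normal (+ n)))
  (Q.*≤* (subst₂ ℤ._≤_ (sym (ℤP.*-identityʳ (+ m))) (sym (ℤP.*-identityʳ (+ n))) (ℤ.+≤+ m≤n)))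

half-as-product : ∀ w → w / 2 ≡ ι w Q.* ½
half-as-product w = sym (trans (cong (Q._* ½) (ι-normal w)) (cong (_/ 2) (ℤP.*-identityʳ w)))

module Identities where
  open +-*-Solver

  cube : ∀ t W → f t (W Q.* ½) ≡ ½ Q.* ½ Q.* ½ Q.* (W Q.* W Q.* (W Q.- ι (+ 3) Q.* t))
  cube = solve 2 (λ t W → (W :* con ½) :* (W :* con ½) :* (W :* con ½) :- con (+ 3 / 2) :* t :* (W :* con ½) :* (W :* con ½)
                        := con ½ :* con ½ :* con ½ :* (W :* W :* (W :- con (ι (+ 3)) :* t))) refl

  eighth-of-4 : ∀ W → ½ Q.* ½ Q.* ½ Q.* (ι (+ 4) Q.* W) ≡ W Q.* ½
  eighth-of-4 = solve 1 (λ W → con ½ :* con ½ :* con ½ :* (con (ι (+ 4)) :* W) := W :* con ½) refl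

  eighth-of-2 : ∀ Y → ½ Q.* ½ Q.* ½ Q.* (ι (+ 2) Q.* Y) Q.* ι (+ 4) ≡ Y
  eighth-of-2 = solve 1 (λ Y → con ½ :* con ½ :* con ½ :* (con (ι (+ 2)) :* Y) :* con (ι (+ 4)) := Y) refl

  double-half : ∀ X → ι (+ 2) Q.* X Q.* ½ ≡ X
  double-half = solve 1 (λ X → con (ι (+ 2)) :* X :* con ½ := X) refl

  -- f t x · N³ = (xN)³ − 3t (xN)² (N/2), written with N = 2H.
  scaled : ∀ t x H → f t x Q.* ((ι (+ 2) Q.* H) Q.* (ι (+ 2) Q.* H) Q.* (ι (+ 2) Q.* H))
                   ≡ (x Q.* (ι (+ 2) Q.* H)) Q.* (x Q.* (ι (+ 2) Q.* H)) Q.* (x Q.* (ι (+ 2) Q.* H))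
                     Q.- ι (+ 3) Q.* t Q.* ((x Q.* (ι (+ 2) Q.* H)) Q.* (x Q.* (ι (+ 2) Q.* H))) Q.* H
  scaled = solve 3 (λ t x H →
      (x :* x :* x :- con (+ 3 / 2) :* t :* x :* x) :* ((con (ι (+ 2)) :* H) :* (con (ι (+ 2)) :* H) :* (con (ι (+ 2)) :* H))
    := (x :* (con (ι (+ 2)) :* H)) :* (x :* (con (ι (+ 2)) :* H)) :* (x :* (con (ι (+ 2)) :* H))
       :- con (ι (+ 3)) :* t :* ((x :* (con (ι (+ 2)) :* H)) :* (x :* (con (ι (+ 2)) :* H))) :* H) refl

  zero-fixed : ∀ t → f t 0ℚ ≡ 0ℚ
  zero-fixed = solve 1 (λ t → con 0ℚ :* con 0ℚ :* con 0ℚ :- con (+ 3 / 2) :* t :* con 0ℚ :* con 0ℚ := con 0ℚ) refl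

-- The rescaled dynamics.  For t = ι T and z = w/2 the map f_t reads w ↦ w² (w − 3T) / 4;
-- Step T w w′ says that this value is the integer w′.
record Step (T w w′ : ℤ) : Set where
  constructor step
  field equation : + 4 * w′ ≡ w * w * (w - + 3 * T)

record QuarterStep (T w s w′ : ℤ) : Set where
  constructor quarter-step
  field
    quarter : w - + 3 * T ≡ + 4 * s
    product : w * w * s ≡ w′

quarter⇒step : ∀ {T w s w′} → QuarterStep T w s w′ → Step T w w′
quarter⇒step {T} {w} {s} {w′} (quarter-step w-3T≡4s w²s≡w′) = step (begin
  + 4 * w′               ≡⟨ cong (λ v → + 4 * v) (sym w²s≡w′) ⟩
  + 4 * (w * w * s)      ≡⟨ solve-ℤ (w ∷ s ∷ []) ⟩
  w * w * (+ 4 * s)      ≡⟨ cong (λ v → w * w * v) (sym w-3T≡4s) ⟩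
  w * w * (w - + 3 * T)  ∎)
  where open ≡-Reasoning

-- Steps are stated for normalised expressions of T and w; this transports them.
step-at : ∀ {T T′ w v w′} → T ≡ T′ → w ≡ v → Step T′ v w′ → Step T w w′
step-at refl refl st = st

first-step : ∀ T → Step T (+ 2 * T) (- (T * T * T))
first-step T = step (solve-ℤ (T ∷ []))

ι-cubic : ∀ T w → ι (w * w * (w - + 3 * T)) ≡ ι w Q.* ι w Q.* (ι w Q.- ι (+ 3) Q.* ι T)
ι-cubic T w = trans (ι-* (w * w) (w - + 3 * T))
  (cong₂ Q._*_ (ι-* w w) (trans (ι-- w (+ 3 * T)) (cong (λ q → ι w Q.- q) (ι-* (+ 3) T))))

rescaled-cube : ∀ T w → f (ι T) (w / 2) ≡ ½ Q.* ½ Q.* ½ Q.* ι (w * w * (w - + 3 * T))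
rescaled-cube T w = begin
  f (ι T) (w / 2)                 ≡⟨ cong (f (ι T)) (half-as-product w) ⟩
  f (ι T) (ι w Q.* ½)             ≡⟨ Identities.cube (ι T) (ι w) ⟩
  ½ Q.* ½ Q.* ½ Q.* (ι w Q.* ι w Q.* (ι w Q.- ι (+ 3) Q.* ι T))
                                  ≡⟨ cong (λ q → ½ Q.* ½ Q.* ½ Q.* q) (sym (ι-cubic T w)) ⟩
  ½ Q.* ½ Q.* ½ Q.* ι (w * w * (w - + 3 * T)) ∎
  where open ≡-Reasoning

halving-step : ∀ {T w w′} → Step T w w′ → f (ι T) (w / 2) ≡ w′ / 2
halving-step {T} {w} {w′} (step 4w′≡) = begin
  f (ι T) (w / 2)                              ≡⟨ rescaled-cube T w ⟩
  ½ Q.* ½ Q.* ½ Q.* ι (w * w * (w - + 3 * T))  ≡⟨ cong (λ v → ½ Q.* ½ Q.* ½ Q.* ι v) (sym 4w′≡) ⟩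
  ½ Q.* ½ Q.* ½ Q.* ι (+ 4 * w′)               ≡⟨ cong (λ q → ½ Q.* ½ Q.* ½ Q.* q) (ι-* (+ 4) w′) ⟩
  ½ Q.* ½ Q.* ½ Q.* (ι (+ 4) Q.* ι w′)         ≡⟨ Identities.eighth-of-4 (ι w′) ⟩
  ι w′ Q.* ½                                   ≡⟨ sym (half-as-product w′) ⟩
  w′ / 2                                       ∎
  where open ≡-Reasoning

-- When w − 3T is only divisible by 2, the next point has 2-adic size 4: f (w/2) · 4 = w² u.
leaving-step : ∀ {T w u} → w - + 3 * T ≡ + 2 * u → f (ι T) (w / 2) Q.* ι (+ 4) ≡ ι (w * w * u)
leaving-step {T} {w} {u} w-3T≡2u = begin
  f (ι T) (w / 2) Q.* ι (+ 4)                              ≡⟨ cong (Q._* ι (+ 4)) (rescaled-cube T w) ⟩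
  ½ Q.* ½ Q.* ½ Q.* ι (w * w * (w - + 3 * T)) Q.* ι (+ 4) ≡⟨ cong (λ v → ½ Q.* ½ Q.* ½ Q.* ι v Q.* ι (+ 4)) regroup ⟩
  ½ Q.* ½ Q.* ½ Q.* ι (+ 2 * (w * w * u)) Q.* ι (+ 4)     ≡⟨ cong (λ q → ½ Q.* ½ Q.* ½ Q.* q Q.* ι (+ 4)) (ι-* (+ 2) (w * w * u)) ⟩
  ½ Q.* ½ Q.* ½ Q.* (ι (+ 2) Q.* ι (w * w * u)) Q.* ι (+ 4) ≡⟨ Identities.eighth-of-2 (ι (w * w * u)) ⟩
  ι (w * w * u)                                            ∎
  where
  open ≡-Reasoning
  regroup : w * w * (w - + 3 * T) ≡ + 2 * (w * w * u)
  regroup = trans (cong (λ v → w * w * v) w-3T≡2u) (solve-ℤ (w ∷ u ∷ []))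

ι-as-half : ∀ a → ι a ≡ (+ 2 * a) / 2
ι-as-half a = sym (begin
  (+ 2 * a) / 2            ≡⟨ half-as-product (+ 2 * a) ⟩
  ι (+ 2 * a) Q.* ½        ≡⟨ cong (Q._* ½) (ι-* (+ 2) a) ⟩
  ι (+ 2) Q.* ι a Q.* ½    ≡⟨ Identities.double-half (ι a) ⟩
  ι a                      ∎)
  where open ≡-Reasoning

zero-orbit : ∀ t n → iter (f t) n 0ℚ ≡ 0ℚ
zero-orbit t zero    = refl
zero-orbit t (suc n) = trans (cong (f t) (zero-orbit t n)) (Identities.zero-fixed t)

/-cross : ∀ a A b B → a / suc A ≡ b / suc B → a * + suc B ≡ b * + suc A
/-cross a A b B eq with ℚP./-injective-≃ (mkℚᵘ a A) (mkℚᵘ b B) eq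
... | *≡* e = e

pow-v₂-aux-∣ : ∀ fuel n → 2 ^ v₂-aux fuel n ∣ n
pow-v₂-aux-∣ zero       n       = ℕ∣.1∣ n
pow-v₂-aux-∣ (suc fuel) zero    = ℕ∣.1∣ 0
pow-v₂-aux-∣ (suc fuel) (suc n) with suc n ℕ.% 2 in r
... | zero  = subst (2 ^ suc (v₂-aux fuel (suc n ℕ./ 2)) ∣_) (sym halves)
                    (ℕ∣.*-monoʳ-∣ 2 (pow-v₂-aux-∣ fuel (suc n ℕ./ 2)))
  where
  halves : suc n ≡ 2 ℕ.* (suc n ℕ./ 2)
  halves = trans (ℕD.m≡m%n+[m/n]*n (suc n) 2)
                 (trans (cong (ℕ._+ (suc n ℕ./ 2) ℕ.* 2) r) (ℕP.*-comm (suc n ℕ./ 2) 2))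
... | suc _ = ℕ∣.1∣ (suc n)

pow-v₂≤ : ∀ n → 2 ^ v₂ (suc n) ℕ.≤ suc n
pow-v₂≤ n = ℕ∣.∣⇒≤ (pow-v₂-aux-∣ (suc n) (suc n))

v₂-aux-even : ∀ fuel n → suc n ℕ.% 2 ≡ 0 → v₂-aux (suc fuel) (suc n) ≡ suc (v₂-aux fuel (suc n ℕ./ 2))
v₂-aux-even fuel n even with suc n ℕ.% 2 | even
... | .0 | refl = refl

v₂-aux-double : ∀ fuel m .{{_ : ℕ.NonZero m}} → v₂-aux (suc fuel) (2 ℕ.* m) ≡ suc (v₂-aux fuel m)
v₂-aux-double fuel m@(suc n) = trans (v₂-aux-even fuel (n ℕ.+ suc (n ℕ.+ 0)) even)
                                     (cong (λ k → suc (v₂-aux fuel k)) half)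
  where
  even : (2 ℕ.* m) ℕ.% 2 ≡ 0
  even = trans (cong (ℕ._% 2) (ℕP.*-comm 2 m)) (ℕD.m*n%n≡0 m 2)
  half : (2 ℕ.* m) ℕ./ 2 ≡ m
  half = trans (cong (ℕ._/ 2) (ℕP.*-comm 2 m)) (ℕD.m*n/n≡m m 2)

n<2^n : ∀ n → n ℕ.< 2 ^ n
n<2^n zero    = s≤s z≤n
n<2^n (suc n) = subst (ℕ._≤ 2 ^ suc n) (ℕP.+-comm (suc n) 1)
  (ℕP.+-mono-≤ (n<2^n n) (subst (1 ℕ.≤_) (sym (ℕP.+-identityʳ (2 ^ n))) (ℕP.m^n>0 2 n)))

v₂-aux-pow : ∀ fuel e → e ℕ.≤ fuel → v₂-aux fuel (2 ^ e) ≡ e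
v₂-aux-pow zero       zero    _         = refl
v₂-aux-pow (suc fuel) zero    _         = refl
v₂-aux-pow (suc fuel) (suc e) (s≤s e≤f) =
  trans (v₂-aux-double fuel (2 ^ e) {{ℕP.m^n≢0 2 e}}) (cong suc (v₂-aux-pow fuel e e≤f))

v₂-pow : ∀ e → v₂ (2 ^ e) ≡ e
v₂-pow e = v₂-aux-pow (2 ^ e) e (ℕP.<⇒≤ (n<2^n e))

v₂-odd : ∀ n → ¬ (2 ∣ n) → v₂ n ≡ 0
v₂-odd zero    ¬2∣n = ⊥-elim (¬2∣n (2 ℕ∣.∣0))
v₂-odd (suc n) ¬2∣n with suc n ℕ.% 2 in r
... | zero  = ⊥-elim (¬2∣n (ℕ∣.m%n≡0⇒n∣m (suc n) 2 r))
... | suc _ = refl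

abs₂-unfold : ∀ x a → ℤ.∣ ↥ x ∣ ≡ suc a →
              ∣ x ∣₂ ≡ _/_ (+ (2 ^ v₂ (↧ₙ x))) (2 ^ v₂ (suc a)) {{ℕP.m^n≢0 2 (v₂ (suc a))}}
abs₂-unfold x a eq with ℤ.∣ ↥ x ∣ | eq
... | .(suc a) | refl = refl

fraction-≤ : ∀ p n m .{{_ : ℕ.NonZero n}} → p ℕ.≤ m → (+ p) / n Q.≤ ι (+ m)
fraction-≤ p n@(suc N) m p≤m = go ((+ p) / n) refl
  where
  go : ∀ y → y ≡ (+ p) / n → y Q.≤ ι (+ m)
  go (mkℚ k d c) eq = subst (mkℚ k d c Q.≤_) (sym (ι-normal (+ m)))
      (Q.*≤* (bound k (/-cross k d (+ p) N (trans (ℚP.↥p/↧p≡p (mkℚ k d c)) eq))))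
    where
    bound : ∀ k → k * + suc N ≡ + p * + suc d → k * + 1 ℤ.≤ + m * + suc d
    bound (+ u) e = subst₂ ℤ._≤_ (sym (ℤP.*-identityʳ (+ u))) (ℤP.pos-* m (suc d)) (ℤ.+≤+ u≤m·d)
      where
      open ℕP.≤-Reasoning
      u≤m·d : u ℕ.≤ m ℕ.* suc d
      u≤m·d = begin
        u               ≤⟨ ℕP.m≤m*n u (suc N) ⟩
        u ℕ.* suc N     ≡⟨ ℤP.+-injective (trans (ℤP.pos-* u (suc N)) (trans e (sym (ℤP.pos-* p (suc d))))) ⟩
        p ℕ.* suc d     ≤⟨ ℕP.*-monoˡ-≤ (suc d) p≤m ⟩
        m ℕ.* suc d     ∎
    bound -[1+ u ] e = subst₂ ℤ._≤_ (sym (ℤP.*-identityʳ -[1+ u ])) (ℤP.pos-* m (suc d)) ℤ.-≤+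

abs₂≤denominator : ∀ x → ∣ x ∣₂ Q.≤ ι (+ ↧ₙ x)
abs₂≤denominator x with ℤ.∣ ↥ x ∣
... | zero  = ι-mono {0} {↧ₙ x} z≤n
... | suc a = fraction-≤ (2 ^ v₂ (↧ₙ x)) (2 ^ v₂ (suc a)) (↧ₙ x) {{ℕP.m^n≢0 2 (v₂ (suc a))}}
                         (pow-v₂≤ (Q.ℚ.denominator-1 x))

denominator-≤ : ∀ i n .{{_ : ℕ.NonZero n}} → ↧ₙ (i / n) ℕ.≤ n
denominator-≤ i n = ℕ∣.∣⇒≤ (divides g (sym (trans (ℕP.*-comm g (↧ₙ (i / n)))
  (ℤP.+-injective (trans (ℤP.pos-* (↧ₙ (i / n)) g) (ℚP.↧-/ i n))))))
  where g = gcd ℤ.∣ i ∣ n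

half-integer-bound : ∀ w → ∣ w / 2 ∣₂ Q.≤ ι (+ 2)
half-integer-bound w = ℚP.≤-trans (abs₂≤denominator (w / 2)) (ι-mono (denominator-≤ w 2))

Odd : ℤ → Set
Odd o = Σ ℤ λ a → o ≡ + 2 * a + + 1

odd-* : ∀ {a b} → Odd a → Odd b → Odd (a * b)
odd-* (x , refl) (y , refl) = + 2 * x * y + x + y , solve-ℤ (x ∷ y ∷ [])

odd-minus-even : ∀ {a} → Odd a → ∀ b → Odd (a - + 2 * b)
odd-minus-even (x , refl) b = x - b , solve-ℤ (x ∷ b ∷ [])

odd⇒¬2∣ : ∀ {o} → Odd o → ¬ (2 ∣ ℤ.∣ o ∣)
odd⇒¬2∣ {o} (a , refl) 2∣o with ℕ∣.∣1⇒≡1 (ℤ∣.∣⇒∣ᵤ 2∣1)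
  where
  2∣1 : + 2 ℤ∣.∣ + 1
  2∣1 = ℤ∣.∣m+n∣m⇒∣n (ℤ∣.∣ᵤ⇒∣ {+ 2} {o} 2∣o) (ℤ∣.∣m⇒∣m*n a (ℤ∣.∣-refl {+ 2}))
... | ()

power-of-two-∣ : ∀ e {o D} → ¬ (2 ∣ o) → 2 ^ e ∣ o ℕ.* D → 2 ^ e ∣ D
power-of-two-∣ zero    {o} {D} _    _  = ℕ∣.1∣ D
power-of-two-∣ (suc e) {o} {D} ¬2∣o dv with euclidsLemma o D prime[2] (ℕ∣.∣-trans (ℕ∣.m∣m*n (2 ^ e)) dv)
... | inj₁ 2∣o = ⊥-elim (¬2∣o 2∣o)
... | inj₂ (divides D′ refl) = subst (2 ^ suc e ∣_) (ℕP.*-comm 2 D′)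
        (ℕ∣.*-monoʳ-∣ 2 (power-of-two-∣ e ¬2∣o (ℕ∣.*-cancelˡ-∣ 2 (subst (2 ^ suc e ∣_) regroup dv))))
  where
  regroup : o ℕ.* (D′ ℕ.* 2) ≡ 2 ℕ.* (o ℕ.* D′)
  regroup = solve-ℕ (o ∷ D′ ∷ [])

pow-fraction : ∀ {j j′ k k′} → j ≡ j′ → k ≡ k′ →
               _/_ (+ (2 ^ j)) (2 ^ k) {{ℕP.m^n≢0 2 k}} ≡ _/_ (+ (2 ^ j′)) (2 ^ k′) {{ℕP.m^n≢0 2 k′}}
pow-fraction refl refl = refl

-- If x · 2^e is an odd integer then x = odd / 2^e in lowest terms, so |x|₂ = 2^e.
abs₂-exact : ∀ x e o → Odd o → x Q.* ι (+ (2 ^ e)) ≡ ι o → ∣ x ∣₂ ≡ ι (+ (2 ^ e))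
abs₂-exact (mkℚ n d c) e o odd x·N≡o with ℤ.∣ o ∣ in ∣o∣≡
... | zero  = ⊥-elim (odd⇒¬2∣ odd (subst (2 ∣_) (sym ∣o∣≡) (2 ℕ∣.∣0)))
... | suc a = trans (abs₂-unfold (mkℚ n d c) a (trans ∣n∣≡∣o∣ ∣o∣≡))
                    (pow-fraction (trans (cong v₂ D≡N) (v₂-pow e))
                                  (v₂-odd (suc a) (subst (λ k → ¬ (2 ∣ k)) ∣o∣≡ (odd⇒¬2∣ odd))))
  where
  N = 2 ^ e
  open ≡-Reasoning
  cross : n * + N * + 1 ≡ o * + suc (d ℕ.* 1)
  cross = /-cross (n * + N) (d ℕ.* 1) o 0 (trans (sym (cong (mkℚ n d c Q.*_) (ι-normal (+ N)))) x·N≡o)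
  key : ℤ.∣ n ∣ ℕ.* N ≡ ℤ.∣ o ∣ ℕ.* suc d
  key = begin
    ℤ.∣ n ∣ ℕ.* N                 ≡⟨ sym (ℤP.abs-* n (+ N)) ⟩
    ℤ.∣ n * + N ∣                 ≡⟨ cong ℤ.∣_∣ (sym (ℤP.*-identityʳ (n * + N))) ⟩
    ℤ.∣ n * + N * + 1 ∣           ≡⟨ cong ℤ.∣_∣ cross ⟩
    ℤ.∣ o * + suc (d ℕ.* 1) ∣     ≡⟨ ℤP.abs-* o _ ⟩
    ℤ.∣ o ∣ ℕ.* suc (d ℕ.* 1)     ≡⟨ cong (λ k → ℤ.∣ o ∣ ℕ.* suc k) (ℕP.*-identityʳ d) ⟩
    ℤ.∣ o ∣ ℕ.* suc d             ∎
  D≡N : suc d ≡ N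
  D≡N = ℕ∣.∣-antisym (Coprimality.coprime-divisor (Coprimality.sym (Coprimality.recompute c)) (divides ℤ.∣ o ∣ key))
                     (power-of-two-∣ e (odd⇒¬2∣ odd) (divides ℤ.∣ n ∣ (sym key)))
  ∣n∣≡∣o∣ : ℤ.∣ n ∣ ≡ ℤ.∣ o ∣
  ∣n∣≡∣o∣ = ℕP.*-cancelʳ-≡ ℤ.∣ n ∣ ℤ.∣ o ∣ N {{ℕP.m^n≢0 2 e}} (trans key (cong (ℤ.∣ o ∣ ℕ.*_) D≡N))

ι-≤⇒≤-numerator : ∀ N x → ι (+ N) Q.≤ x → N ℕ.≤ ℤ.∣ ↥ x ∣
ι-≤⇒≤-numerator N (mkℚ p d c) le with subst (Q._≤ mkℚ p d c) (ι-normal (+ N)) le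
... | Q.*≤* le′ = bound p (subst₂ ℤ._≤_ (sym (ℤP.pos-* N (suc d))) (ℤP.*-identityʳ p) le′)
  where
  bound : ∀ p → + (N ℕ.* suc d) ℤ.≤ p → N ℕ.≤ ℤ.∣ p ∣
  bound (+ p′) (ℤ.+≤+ le″) = ℕP.≤-trans (ℕP.m≤m*n N (suc d)) le″

unbounded : ∀ t c → (∀ j → Σ ℕ λ n → Σ ℕ λ e → j ℕ.≤ e × ∣ iter (f t) n c ∣₂ ≡ ι (+ (2 ^ e))) →
            ¬ BoundedOrbit t c
unbounded t c large (B , bound) with large ℤ.∣ ↥ B ∣
... | n , e , j≤e , size = ℕP.<-irrefl refl
  (ℕP.<-≤-trans (ℕP.≤-<-trans j≤e (n<2^n e)) (ι-≤⇒≤-numerator (2 ^ e) B (subst (Q._≤ B) size (bound n))))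

-- x has exact 2-adic size 2^e, witnessed by the odd integer x · 2^e.
Escaping : ℕ → ℚ → Set
Escaping e x = Σ ℤ λ o → Odd o × x Q.* ι (+ (2 ^ e)) ≡ ι o

escaping⇒size : ∀ {e x} → Escaping e x → ∣ x ∣₂ ≡ ι (+ (2 ^ e))
escaping⇒size {e} {x} (o , odd , x·2^e≡o) = abs₂-exact x e o odd x·2^e≡o

ι-pow-cube : ∀ E → ι (+ (2 ^ (E ℕ.+ E ℕ.+ E))) ≡ ι (+ (2 ^ E)) Q.* ι (+ (2 ^ E)) Q.* ι (+ (2 ^ E))
ι-pow-cube E = begin
  ι (+ (2 ^ (E ℕ.+ E ℕ.+ E)))                 ≡⟨ cong (λ k → ι (+ k)) (ℕP.^-distribˡ-+-* 2 (E ℕ.+ E) E) ⟩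
  ι (+ (2 ^ (E ℕ.+ E) ℕ.* 2 ^ E))             ≡⟨ cong (λ k → ι (+ (k ℕ.* 2 ^ E))) (ℕP.^-distribˡ-+-* 2 E E) ⟩
  ι (+ (2 ^ E ℕ.* 2 ^ E ℕ.* 2 ^ E))           ≡⟨ cong ι (trans (ℤP.pos-* (2 ^ E ℕ.* 2 ^ E) (2 ^ E))
                                                            (cong (_* + (2 ^ E)) (ℤP.pos-* (2 ^ E) (2 ^ E)))) ⟩
  ι (+ (2 ^ E) * + (2 ^ E) * + (2 ^ E))       ≡⟨ trans (ι-* (+ (2 ^ E) * + (2 ^ E)) (+ (2 ^ E)))
                                                       (cong (Q._* ι (+ (2 ^ E))) (ι-* (+ (2 ^ E)) (+ (2 ^ E)))) ⟩
  ι (+ (2 ^ E)) Q.* ι (+ (2 ^ E)) Q.* ι (+ (2 ^ E)) ∎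
  where open ≡-Reasoning

-- Once |x|₂ = 2^E with E ≥ 2 the cubic term of f_t dominates, and |f_t x|₂ = 2^(3E).
escape-step : ∀ T e x → Escaping (2 ℕ.+ e) x →
              Escaping ((2 ℕ.+ e) ℕ.+ (2 ℕ.+ e) ℕ.+ (2 ℕ.+ e)) (f (ι T) x)
escape-step T e x (o , odd , x·N≡o) = o′ , odd-o′ , fx·N³≡o′
  where
  open ≡-Reasoning
  E = 2 ℕ.+ e
  H′ = + 2 * + (2 ^ e)
  H = ι H′
  o′ = o * o * o - + 3 * T * (o * o) * H′

  odd-o′ : Odd o′
  odd-o′ = subst Odd (cong (λ v → o * o * o - v) (regroup T o (+ (2 ^ e))))
                 (odd-minus-even (odd-* (odd-* odd odd) odd) (+ 3 * T * (o * o) * + (2 ^ e)))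
    where
    regroup : ∀ T o P → + 2 * (+ 3 * T * (o * o) * P) ≡ + 3 * T * (o * o) * (+ 2 * P)
    regroup = solve-∀

  N≡2H : ι (+ (2 ^ E)) ≡ ι (+ 2) Q.* H
  N≡2H = trans (cong ι (trans (ℤP.pos-* 2 (2 ^ suc e)) (cong (λ v → + 2 * v) (ℤP.pos-* 2 (2 ^ e)))))
               (ι-* (+ 2) H′)

  ι-o′ : ι o′ ≡ ι o Q.* ι o Q.* ι o Q.- ι (+ 3) Q.* ι T Q.* (ι o Q.* ι o) Q.* H
  ι-o′ = trans (ι-- (o * o * o) (+ 3 * T * (o * o) * H′)) (cong₂ Q._-_ ι-cube ι-term)
    where
    ι-cube : ι (o * o * o) ≡ ι o Q.* ι o Q.* ι o
    ι-cube = trans (ι-* (o * o) o) (cong (Q._* ι o) (ι-* o o))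
    ι-term : ι (+ 3 * T * (o * o) * H′) ≡ ι (+ 3) Q.* ι T Q.* (ι o Q.* ι o) Q.* H
    ι-term = trans (ι-* (+ 3 * T * (o * o)) H′)
               (cong (Q._* H) (trans (ι-* (+ 3 * T) (o * o)) (cong₂ Q._*_ (ι-* (+ 3) T) (ι-* o o))))

  fx·N³≡o′ : f (ι T) x Q.* ι (+ (2 ^ (E ℕ.+ E ℕ.+ E))) ≡ ι o′
  fx·N³≡o′ = begin
    f (ι T) x Q.* ι (+ (2 ^ (E ℕ.+ E ℕ.+ E)))
      ≡⟨ cong (f (ι T) x Q.*_) (trans (ι-pow-cube E) (cong (λ N → N Q.* N Q.* N) N≡2H)) ⟩
    f (ι T) x Q.* ((ι (+ 2) Q.* H) Q.* (ι (+ 2) Q.* H) Q.* (ι (+ 2) Q.* H))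
      ≡⟨ Identities.scaled (ι T) x H ⟩
    X Q.* X Q.* X Q.- ι (+ 3) Q.* ι T Q.* (X Q.* X) Q.* H
      ≡⟨ cong (λ y → y Q.* y Q.* y Q.- ι (+ 3) Q.* ι T Q.* (y Q.* y) Q.* H) X≡o ⟩
    ι o Q.* ι o Q.* ι o Q.- ι (+ 3) Q.* ι T Q.* (ι o Q.* ι o) Q.* H
      ≡⟨ sym ι-o′ ⟩
    ι o′ ∎
    where
    X = x Q.* (ι (+ 2) Q.* H)
    X≡o : X ≡ ι o
    X≡o = trans (cong (x Q.*_) (sym N≡2H)) x·N≡o

pow4 : ℕ → ℤ
pow4 i = + (4 ^ i)

pow4-suc : ∀ i → pow4 (suc i) ≡ + 4 * pow4 i
pow4-suc i = ℤP.pos-* 4 (4 ^ i)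

two-pow-split : ∀ {K i r} → i ℕ.+ r ≡ K → 2 ^ (2 ℕ.* (2 ℕ.+ K)) ≡ 16 ℕ.* (4 ^ i ℕ.* 4 ^ r)
two-pow-split {K} {i} {r} refl = begin
  2 ^ (2 ℕ.* (2 ℕ.+ K))      ≡⟨ sym (ℕP.^-*-assoc 2 2 (2 ℕ.+ K)) ⟩
  4 ^ (2 ℕ.+ K)              ≡⟨ sym (ℕP.*-assoc 4 4 (4 ^ K)) ⟩
  16 ℕ.* 4 ^ K               ≡⟨ cong (16 ℕ.*_) (ℕP.^-distribˡ-+-* 4 i r) ⟩
  16 ℕ.* (4 ^ i ℕ.* 4 ^ r)   ∎
  where open ≡-Reasoning

three-pow-split : ∀ {M i r} → i ℕ.+ r ≡ M → 3 ℕ.* 2 ^ (2 ℕ.* (2 ℕ.+ M) ℕ.+ 1) ≡ 96 ℕ.* (4 ^ i ℕ.* 4 ^ r)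
three-pow-split {M} {i} {r} i+r≡M = begin
  3 ℕ.* 2 ^ (2 ℕ.* (2 ℕ.+ M) ℕ.+ 1)    ≡⟨ cong (λ k → 3 ℕ.* 2 ^ k) (ℕP.+-comm (2 ℕ.* (2 ℕ.+ M)) 1) ⟩
  3 ℕ.* (2 ℕ.* 2 ^ (2 ℕ.* (2 ℕ.+ M)))  ≡⟨ cong (λ k → 3 ℕ.* (2 ℕ.* k)) (two-pow-split {M} {i} {r} i+r≡M) ⟩
  3 ℕ.* (2 ℕ.* (16 ℕ.* X))             ≡⟨ arith X ⟩
  96 ℕ.* X                             ∎
  where
  open ≡-Reasoning
  X = 4 ^ i ℕ.* 4 ^ r
  arith : ∀ x → 3 ℕ.* (2 ℕ.* (16 ℕ.* x)) ≡ 96 ℕ.* x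
  arith = solve-∀-ℕ

cast-affine : ∀ c x y → + (1 ℕ.+ c ℕ.* (x ℕ.* y)) ≡ + 1 + + c * + x * + y
cast-affine c x y = trans (ℤP.pos-+ 1 (c ℕ.* (x ℕ.* y)))
  (cong (λ v → + 1 + v) (trans (ℤP.pos-* c (x ℕ.* y))
    (trans (cong (λ v → + c * v) (ℤP.pos-* x y)) (sym (ℤP.*-assoc (+ c) (+ x) (+ y))))))

second-point : ∀ T → f (ι T) (ι T) ≡ (- (T * T * T)) / 2
second-point T = trans (cong (f (ι T)) (ι-as-half T)) (halving-step (first-step T))

-- Certificates for part (1), where T = 1 + 16·P·Q.  In each case s = (w − 3T)/4.
-- Entry: for Q = 1 the point −T³ = 16P(4c + 1) − 1 is sent to level P of the cascade.
entry₁ : ∀ P → let T = + 1 + + 16 * P * + 1 in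
         Σ ℤ λ a → Step T (- (T * T * T)) (+ 8 * P * (+ 2 * a + + 1) - + 1)
entry₁ P =
  let T = + 1 + + 16 * P * + 1
      w = - (T * T * T)
      c = - + 1 - + 12 * P - + 64 * P * P
      s = + 8 * P * (+ 2 * c - + 1) - + 1
  in c - + 1 + (+ 4 * c + + 1) * (w - + 1) * s ,
     quarter⇒step {s = s} (quarter-step (solve-ℤ (P ∷ [])) (solve-ℤ (P ∷ [])))

-- Descent: level 4P goes to level P (w + 1 has 2-adic valuation lowered by 2).
descend₁ : ∀ P Q q → Σ ℤ λ q′ →
  Step (+ 1 + + 16 * (+ 4 * P) * Q) (+ 8 * (+ 4 * P) * (+ 2 * q + + 1) - + 1) (+ 8 * P * (+ 2 * q′ + + 1) - + 1)
descend₁ P Q q =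
  let w = + 8 * (+ 4 * P) * (+ 2 * q + + 1) - + 1
      s = + 8 * P * (+ 2 * q + + 1) - + 1 - + 48 * P * Q
  in q - + 3 * Q + + 2 * (+ 2 * q + + 1) * (w - + 1) * s ,
     quarter⇒step {s = s} (quarter-step (solve-ℤ (P ∷ Q ∷ q ∷ [])) (solve-ℤ (P ∷ Q ∷ q ∷ [])))

land₁ : ∀ Q q → Σ ℤ λ b → Step (+ 1 + + 16 * + 1 * Q) (+ 8 * + 1 * (+ 2 * q + + 1) - + 1) (+ 4 * b + + 1)
land₁ Q q =
  let w = + 8 * + 1 * (+ 2 * q + + 1) - + 1
      s = + 4 * q + + 1 - + 12 * Q
  in q - + 3 * Q + + 2 * (w - + 1) * (+ 2 * q + + 1) * s ,
     quarter⇒step {s = s} (quarter-step (solve-ℤ (Q ∷ q ∷ [])) (solve-ℤ (Q ∷ q ∷ [])))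

leave₁ : ∀ Q b → (+ 4 * b + + 1) - + 3 * (+ 1 + + 16 * + 1 * Q) ≡ + 2 * (+ 2 * (b - + 12 * Q - + 1) + + 1)
leave₁ = solve-∀

-- Certificates for part (2), where T = 1 + 96·P·Q.
-- Entry: for Q = 1 the point −T³ = 32P(8c + 7) − 1 goes to 16P(4a + 3) − 1.
entry₂ : ∀ P → let T = + 1 + + 96 * P * + 1 in
         Σ ℤ λ a → Step T (- (T * T * T)) (+ 16 * P * (+ 4 * a + + 3) - + 1)
entry₂ P =
  let T = + 1 + + 96 * P * + 1
      c = - + 2 - + 108 * P - + 3456 * P * P
      s = + 16 * P * (+ 4 * c - + 1) - + 1
  in c - + 1 + (+ 8 * c + + 7) * (+ 16 * P * (+ 8 * c + + 7) - + 1) * s ,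
     quarter⇒step {s = s} (quarter-step (solve-ℤ (P ∷ [])) (solve-ℤ (P ∷ [])))

realign₂ : ∀ P a → Σ ℤ λ b →
  Step (+ 1 + + 96 * P * + 1) (+ 16 * P * (+ 4 * a + + 3) - + 1) (+ 4 * P * (+ 4 * b + + 1) - + 1)
realign₂ P a =
  let s = + 4 * P * (+ 4 * a - + 15) - + 1
  in a - + 4 + + 2 * (+ 4 * a + + 3) * (+ 8 * P * (+ 4 * a + + 3) - + 1) * s ,
     quarter⇒step {s = s} (quarter-step (solve-ℤ (P ∷ a ∷ [])) (solve-ℤ (P ∷ a ∷ [])))

descend₂ : ∀ P Q q → Σ ℤ λ q′ →
  Step (+ 1 + + 96 * (+ 4 * P) * Q) (+ 4 * (+ 4 * P) * (+ 4 * q + + 1) - + 1) (+ 4 * P * (+ 4 * q′ + + 1) - + 1)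
descend₂ P Q q =
  let s = + 4 * P * (+ 4 * q + + 1) - + 1 - + 288 * P * Q
  in q - + 18 * Q + + 2 * (+ 4 * q + + 1) * (+ 8 * P * (+ 4 * q + + 1) - + 1) * s ,
     quarter⇒step {s = s} (quarter-step (solve-ℤ (P ∷ Q ∷ q ∷ [])) (solve-ℤ (P ∷ Q ∷ q ∷ [])))

land₂ : ∀ Q q → Σ ℤ λ b → Step (+ 1 + + 96 * + 1 * Q) (+ 4 * + 1 * (+ 4 * q + + 1) - + 1) (+ 4 * b)
land₂ Q q =
  let w = + 4 * + 1 * (+ 4 * q + + 1) - + 1
  in w * w * (q - + 18 * Q) ,
     quarter⇒step {s = + 4 * (q - + 18 * Q)} (quarter-step (solve-ℤ (Q ∷ q ∷ [])) (solve-ℤ (Q ∷ q ∷ [])))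

stay₂ : ∀ T q → Step T (+ 4 * q) (+ 4 * (q * q * (+ 4 * q - + 3 * T)))
stay₂ T q = step (solve-ℤ (T ∷ q ∷ []))

-- Writing orbit points as w/2, the point w₂ lies on level K
-- of the cascade  w = 8·4^i·(odd) − 1;  each step lowers the level by one, from level 0 the
-- orbit leaves the half-integers, and from then on its 2-adic size grows without bound.
module Unbounded (K : ℕ) where
  T : ℤ
  T = + (1 ℕ.+ 2 ^ (2 ℕ.* (2 ℕ.+ K)))

  z : ℕ → ℚ
  z n = iter (f (ι T)) n (ι T)

  T-split : ∀ {i r} → i ℕ.+ r ≡ K → T ≡ + 1 + + 16 * pow4 i * pow4 r
  T-split {i} {r} i+r≡K =
    trans (cong (λ k → + (1 ℕ.+ k)) (two-pow-split {K} {i} {r} i+r≡K)) (cast-affine 16 (4 ^ i) (4 ^ r))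

  Level : ℕ → ℤ → Set
  Level i w = Σ ℤ λ q → w ≡ + 8 * pow4 i * (+ 2 * q + + 1) - + 1

  top : Σ ℤ λ w → Level K w × z 2 ≡ w / 2
  top = let (a , st) = entry₁ (pow4 K) in
    _ , (a , refl) ,
    trans (cong (f (ι T)) (second-point T))
          (halving-step (step-at T≡ (cong (λ u → - (u * u * u)) T≡) st))
    where
    T≡ : T ≡ + 1 + + 16 * pow4 K * + 1
    T≡ = T-split {K} {0} (ℕP.+-identityʳ K)

  descent : ∀ i r → i ℕ.+ r ≡ K → ∀ n w → Level i w → z n ≡ w / 2 → Σ ℕ λ m → Escaping 2 (z m)
  descent zero r i+r≡K n w (q , refl) zn =
    let (b , st) = land₁ (pow4 r) q
        w′ = + 4 * b + + 1
        u  = + 2 * (b - + 12 * pow4 r - + 1) + + 1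
        zn′ : z (suc n) ≡ w′ / 2
        zn′ = trans (cong (f (ι T)) zn) (halving-step (step-at (T-split {0} {r} i+r≡K) refl st))
        w′-3T : w′ - + 3 * T ≡ + 2 * u
        w′-3T = trans (cong (λ T′ → w′ - + 3 * T′) (T-split {0} {r} i+r≡K)) (leave₁ (pow4 r) b)
        odd-w′ : Odd w′
        odd-w′ = + 2 * b , cong (_+ + 1) (ℤP.*-assoc (+ 2) (+ 2) b)
    in suc (suc n) , w′ * w′ * u , odd-* (odd-* odd-w′ odd-w′) (b - + 12 * pow4 r - + 1 , refl) ,
       trans (cong (λ x → f (ι T) x Q.* ι (+ 4)) zn′) (leaving-step {T} {w′} {u} w′-3T)
  descent (suc i) r i+r≡K n w (q , refl) zn =
    let (q′ , st) = descend₁ (pow4 i) (pow4 r) q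
        T≡ = trans (T-split {suc i} {r} i+r≡K) (cong (λ P → + 1 + + 16 * P * pow4 r) (pow4-suc i))
        w≡ = cong (λ P → + 8 * P * (+ 2 * q + + 1) - + 1) (pow4-suc i)
    in descent i (suc r) (trans (ℕP.+-suc i r) i+r≡K) (suc n) _ (q′ , refl)
         (trans (cong (f (ι T)) zn) (halving-step (step-at T≡ w≡ st)))

  escapes : ∀ j → Σ ℕ λ n → Σ ℕ λ e → j ℕ.≤ e × Escaping (2 ℕ.+ e) (z n)
  escapes zero =
    let (w , lvl , z₂) = top
        (n , esc) = descent K 0 (ℕP.+-identityʳ K) 2 w lvl z₂
    in n , 0 , z≤n , esc
  escapes (suc j) =
    let (n , e , j≤e , esc) = escapes j
    in suc n , e ℕ.+ (2 ℕ.+ e) ℕ.+ (2 ℕ.+ e) ,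
       ℕP.≤-trans (s≤s j≤e) (ℕP.≤-trans (ℕP.n≤1+n (suc e))
         (ℕP.≤-trans (ℕP.m≤n+m (2 ℕ.+ e) e) (ℕP.m≤m+n (e ℕ.+ (2 ℕ.+ e)) (2 ℕ.+ e)))) ,
       escape-step T e (z n) esc

  not-pcb : ¬ PCB (ι T)
  not-pcb (_ , bounded) = unbounded (ι T) (ι T) large bounded
    where
    large : ∀ j → Σ ℕ λ n → Σ ℕ λ e → j ℕ.≤ e × ∣ z n ∣₂ ≡ ι (+ (2 ^ e))
    large j = let (n , e , j≤e , esc) = escapes j
              in n , 2 ℕ.+ e , ℕP.≤-trans j≤e (ℕP.m≤n+m e 2) , escaping⇒size {2 ℕ.+ e} {z n} esc

-- The orbit of t consists of halves of integers:
-- after three steps it enters the cascade  w = 4·4^i·(4q + 1) − 1,  descends it, and then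
-- stays among the multiples of 4.
module Bounded (M : ℕ) where
  T : ℤ
  T = + (1 ℕ.+ 3 ℕ.* 2 ^ (2 ℕ.* (2 ℕ.+ M) ℕ.+ 1))

  z : ℕ → ℚ
  z n = iter (f (ι T)) n (ι T)

  T-split : ∀ {i r} → i ℕ.+ r ≡ M → T ≡ + 1 + + 96 * pow4 i * pow4 r
  T-split {i} {r} i+r≡M =
    trans (cong (λ k → + (1 ℕ.+ k)) (three-pow-split {M} {i} {r} i+r≡M)) (cast-affine 96 (4 ^ i) (4 ^ r))

  Level : ℕ → ℤ → Set
  Level i w = Σ ℤ λ q → w ≡ + 4 * pow4 i * (+ 4 * q + + 1) - + 1

  -- Integers whose orbit stays among the integers: multiples of 4 and cascade points.
  Trapped : ℤ → Set
  Trapped w = (Σ ℤ λ q → w ≡ + 4 * q) ⊎ (Σ ℕ λ i → Σ ℕ λ r → i ℕ.+ r ≡ M × Level i w)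

  trapped-step : ∀ w → Trapped w → Σ ℤ λ w′ → Trapped w′ × Step T w w′
  trapped-step w (inj₁ (q , refl)) =
    let b = q * q * (+ 4 * q - + 3 * T) in + 4 * b , inj₁ (b , refl) , stay₂ T q
  trapped-step w (inj₂ (zero , r , i+r≡M , (q , refl))) =
    let (b , st) = land₂ (pow4 r) q
    in + 4 * b , inj₁ (b , refl) , step-at (T-split {0} {r} i+r≡M) refl st
  trapped-step w (inj₂ (suc i , r , i+r≡M , (q , refl))) =
    let (q′ , st) = descend₂ (pow4 i) (pow4 r) q
        T≡ = trans (T-split {suc i} {r} i+r≡M) (cong (λ P → + 1 + + 96 * P * pow4 r) (pow4-suc i))
        w≡ = cong (λ P → + 4 * P * (+ 4 * q + + 1) - + 1) (pow4-suc i)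
    in _ , inj₂ (i , suc r , trans (ℕP.+-suc i r) i+r≡M , (q′ , refl)) , step-at T≡ w≡ st

  T≡ : T ≡ + 1 + + 96 * pow4 M * + 1
  T≡ = T-split {M} {0} (ℕP.+-identityʳ M)

  second : Σ ℤ λ a → z 2 ≡ (+ 16 * pow4 M * (+ 4 * a + + 3) - + 1) / 2
  second = let (a , st) = entry₂ (pow4 M) in
    a , trans (cong (f (ι T)) (second-point T))
              (halving-step (step-at T≡ (cong (λ u → - (u * u * u)) T≡) st))

  third : Σ ℤ λ w → Trapped w × z 3 ≡ w / 2
  third =
    let (a , z₂) = second
        (b , st) = realign₂ (pow4 M) a
    in _ , inj₂ (M , 0 , ℕP.+-identityʳ M , (b , refl)) ,
       trans (cong (f (ι T)) z₂) (halving-step (step-at T≡ refl st))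

  trapped-orbit : ∀ m → Σ ℤ λ w → Trapped w × z (3 ℕ.+ m) ≡ w / 2
  trapped-orbit zero    = third
  trapped-orbit (suc m) =
    let (w , trapped , zm) = trapped-orbit m
        (w′ , trapped′ , st) = trapped-step w trapped
    in w′ , trapped′ , trans (cong (f (ι T)) zm) (halving-step st)

  halves : ∀ n → Σ ℤ λ w → z n ≡ w / 2
  halves 0 = + 2 * T , ι-as-half T
  halves 1 = - (T * T * T) , second-point T
  halves 2 = let (a , z₂) = second in + 16 * pow4 M * (+ 4 * a + + 3) - + 1 , z₂
  halves (suc (suc (suc m))) = let (w , _ , zm) = trapped-orbit m in w , zm

  pcb : PCB (ι T)
  pcb = (0ℚ , λ n → subst (λ x → ∣ x ∣₂ Q.≤ 0ℚ) (sym (zero-orbit (ι T) n)) ℚP.≤-refl) ,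
        (ι (+ 2) , λ n → let (w , zn) = halves n in subst (λ x → ∣ x ∣₂ Q.≤ ι (+ 2)) (sym zn) (half-integer-bound w))

proposition6p1 : ((k : ℕ) → 2 ≤ k → ¬ PCB (tA k)) × ((m : ℕ) → 2 ≤ m → PCB (tB m))
proposition6p1 = part₁ , part₂
  where
  part₁ : (k : ℕ) → 2 ≤ k → ¬ PCB (tA k)
  part₁ (suc (suc K)) (s≤s (s≤s z≤n)) = Unbounded.not-pcb K
  part₂ : (m : ℕ) → 2 ≤ m → PCB (tB m)
  part₂ (suc (suc M)) (s≤s (s≤s z≤n)) = Bounded.pcb M
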